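{- Let $A,B\subseteq\omega$ with $B$ infinite, and suppose $A \le^{i}_{c.e.} B$ (i.e. $A$ is c.e. relative to every infinite subset of $B$). Then there is an infinite $C\subseteq B$ with $A \le^{ui}_{c.e.} C$.
   Context: A relative c.e. operator is a c.e. set $\Theta$ of pairs $(\sigma,x)\in 2^{<\omega}\times\omega$, with $\Theta(X)=\{x:\exists\sigma\preceq X,\ (\sigma,x)\in\Theta\}$. $A \le^{ui}_{c.e.} C$ means there is a single relative c.e. operator $\Theta$ with $\Theta(S)=A$ for every infinite $S\subseteq C$. -}

module Defs where

open import Data.Nat using (ℕ; zero; suc; _≤_; _+_; _*_)
open import Data.Bool using (Bool; true; false)
open import Data.Fin using (Fin)
open import Data.Vec using (Vec; []; _∷_; lookup)
open import Data.List using (List; []; _∷_; length)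
open import Data.Product using (Σ; ∃; _×_; _,_)
open import Relation.Binary.PropositionalEquality using (_≡_)

data PR : ℕ → Set where
  zer  : ∀ {n} → PR n
  succ : PR 1
  proj : ∀ {n} → Fin n → PR n
  comp : ∀ {m n} → PR m → Vec (PR n) m → PR n
  prec : ∀ {n} → PR n → PR (suc (suc n)) → PR (suc n)
  mu   : ∀ {n} → PR (suc n) → PR n

mutual
  data _⟦_⟧⇓_ : ∀ {n} → PR n → Vec ℕ n → ℕ → Set where
    ev-zer  : ∀ {n} {xs : Vec ℕ n} → zer ⟦ xs ⟧⇓ 0
    ev-succ : ∀ {x} → succ ⟦ x ∷ [] ⟧⇓ suc x
    ev-proj : ∀ {n} {i : Fin n} {xs} → proj i ⟦ xs ⟧⇓ lookup xs i
    ev-comp : ∀ {m n} {f : PR m} {gs : Vec (PR n) m} {xs ys y} →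
              gs ⟦ xs ⟧⇓* ys → f ⟦ ys ⟧⇓ y → comp f gs ⟦ xs ⟧⇓ y
    ev-prec0 : ∀ {n} {f : PR n} {g} {xs y} →
               f ⟦ xs ⟧⇓ y → prec f g ⟦ 0 ∷ xs ⟧⇓ y
    ev-precS : ∀ {n} {f : PR n} {g} {k xs z y} →
               prec f g ⟦ k ∷ xs ⟧⇓ z → g ⟦ k ∷ z ∷ xs ⟧⇓ y →
               prec f g ⟦ suc k ∷ xs ⟧⇓ y
    ev-mu   : ∀ {n} {f : PR (suc n)} {xs y} →
              MuFrom f xs 0 y → mu f ⟦ xs ⟧⇓ y

  data _⟦_⟧⇓*_ : ∀ {m n} → Vec (PR n) m → Vec ℕ n → Vec ℕ m → Set where
    ev-[] : ∀ {n} {xs : Vec ℕ n} → [] ⟦ xs ⟧⇓* []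
    ev-∷  : ∀ {m n} {g : PR n} {gs : Vec (PR n) m} {xs y ys} →
            g ⟦ xs ⟧⇓ y → gs ⟦ xs ⟧⇓* ys → (g ∷ gs) ⟦ xs ⟧⇓* (y ∷ ys)

  data MuFrom {n} (f : PR (suc n)) (xs : Vec ℕ n) : ℕ → ℕ → Set where
    mu-stop : ∀ {k} → f ⟦ k ∷ xs ⟧⇓ 0 → MuFrom f xs k k
    mu-step : ∀ {k w y} → f ⟦ k ∷ xs ⟧⇓ suc w → MuFrom f xs (suc k) y →
              MuFrom f xs k y

Setℕ : Set
Setℕ = ℕ → Bool

_∈_ : ℕ → Setℕ → Set
x ∈ X = X x ≡ true

_⊆_ : Setℕ → Setℕ → Set
S ⊆ B = ∀ n → n ∈ S → n ∈ B

Infinite : Setℕ → Set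
Infinite S = ∀ n → ∃ λ m → n ≤ m × m ∈ S

Str : Set
Str = List Bool

-- bijective coding of 2^{<ω} by ℕ
⌜_⌝ : Str → ℕ
⌜ [] ⌝ = 0
⌜ false ∷ σ ⌝ = 1 + 2 * ⌜ σ ⌝
⌜ true ∷ σ ⌝ = 2 + 2 * ⌜ σ ⌝

_↾_ : Setℕ → ℕ → Str
X ↾ zero = []
X ↾ suc n = X 0 ∷ ((λ k → X (suc k)) ↾ n)

_≼_ : Str → Setℕ → Set
σ ≼ X = σ ≡ X ↾ length σ

-- Relative c.e. operators: a c.e. set Θ of pairs (σ , x), given as the
-- domain of a partial recursive function of two arguments (⌜σ⌝ , x).

Operator : Set
Operator = PR 2

_∈Θ_ : Str × ℕ → Operator → Set
(σ , x) ∈Θ Θ = ∃ λ y → Θ ⟦ ⌜ σ ⌝ ∷ x ∷ [] ⟧⇓ y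

_∈Θ⟨_⟩ : ℕ → Operator × Setℕ → Set
x ∈Θ⟨ (Θ , X) ⟩ = ∃ λ σ → σ ≼ X × (σ , x) ∈Θ Θ

_⟨_⟩≡_ : Operator → Setℕ → Setℕ → Set
Θ ⟨ X ⟩≡ A = ∀ x → (x ∈ A → x ∈Θ⟨ (Θ , X) ⟩) × (x ∈Θ⟨ (Θ , X) ⟩ → x ∈ A)

CEin : Setℕ → Setℕ → Set
CEin A X = ∃ λ (Θ : Operator) → Θ ⟨ X ⟩≡ A

_≤ⁱ-ce_ : Setℕ → Setℕ → Set
A ≤ⁱ-ce B = ∀ S → S ⊆ B → Infinite S → CEin A S

_≤ᵘⁱ-ce_ : Setℕ → Setℕ → Set
A ≤ᵘⁱ-ce C = ∃ λ (Θ : Operator) → ∀ S → S ⊆ C → Infinite S → Θ ⟨ S ⟩≡ A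

module Submission where

-- Suppose no infinite C ⊆ B has A ≤ᵘⁱ-ce C; we build an infinite G ⊆ B in which A is not c.e.,
-- contradicting A ≤ⁱ-ce B. G is Mathias generic for conditions (stem φ, reservoir X ⊆ B) meeting,
-- for each operator e, a condition forcing e(G) ≠ A. Given e and a condition, either some Y in
-- the condition enumerates a non-member of A through a finite segment, and we fix that segment;
-- or some x ∈ A is enumerated by no Y in a smaller condition, and we pass to it; or neither, and
-- then "x ∈ Θ(S) iff some τ compatible with φ and S has (τ, x) ∈ e" defines a single operator
-- with Θ(S) = A for every infinite S in the reservoir, which was excluded.

open import Defs
open import Axiom.ExcludedMiddle using (ExcludedMiddle)
open import Data.Bool using (Bool; true; false)
open import Data.Empty using (⊥; ⊥-elim)
open import Data.Fin using (Fin; zero; suc; toℕ)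
open import Data.List using (List; []; _∷_; length; drop; head)
open import Data.List.Properties using (drop-drop; drop-all; drop-[])
open import Data.Maybe using (Maybe; just; nothing; maybe; fromMaybe)
open import Data.Nat using (ℕ; zero; suc; pred; _+_; _*_; _∸_; _≤_; _<_; _⊔_; z≤n; s≤s; _<?_; _≤′_; ≤′-refl; ≤′-step)
open import Data.Nat.Properties
open import Data.Product using (Σ; ∃; _×_; _,_; proj₁; proj₂)
open import Data.Sum using (inj₁; inj₂)
open import Data.Vec using (Vec; []; _∷_; lookup; map; tabulate)
open import Data.Vec.Properties using (tabulate∘lookup; tabulate-∘)
open import Function using (_⇔_; mk⇔; Equivalence)
open import Level using (0ℓ)
open import Relation.Binary.PropositionalEquality
open import Relation.Nullary using (¬_; yes; no; decidable-stable)

mutual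
  ⇓-deterministic : ∀ {n} {f : PR n} {xs a b} → f ⟦ xs ⟧⇓ a → f ⟦ xs ⟧⇓ b → a ≡ b
  ⇓-deterministic ev-zer ev-zer = refl
  ⇓-deterministic ev-succ ev-succ = refl
  ⇓-deterministic ev-proj ev-proj = refl
  ⇓-deterministic (ev-comp p q) (ev-comp p′ q′) with ⇓*-deterministic p p′
  ... | refl = ⇓-deterministic q q′
  ⇓-deterministic (ev-prec0 p) (ev-prec0 q) = ⇓-deterministic p q
  ⇓-deterministic (ev-precS p q) (ev-precS p′ q′) with ⇓-deterministic p p′
  ... | refl = ⇓-deterministic q q′
  ⇓-deterministic (ev-mu p) (ev-mu q) = MuFrom-deterministic p q

  ⇓*-deterministic : ∀ {m n} {gs : Vec (PR n) m} {xs as bs} →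
                     gs ⟦ xs ⟧⇓* as → gs ⟦ xs ⟧⇓* bs → as ≡ bs
  ⇓*-deterministic ev-[] ev-[] = refl
  ⇓*-deterministic (ev-∷ p ps) (ev-∷ q qs) = cong₂ _∷_ (⇓-deterministic p q) (⇓*-deterministic ps qs)

  MuFrom-deterministic : ∀ {n} {f : PR (suc n)} {xs k a b} →
                         MuFrom f xs k a → MuFrom f xs k b → a ≡ b
  MuFrom-deterministic (mu-stop p) (mu-stop q) = refl
  MuFrom-deterministic (mu-stop p) (mu-step q _) with ⇓-deterministic p q
  ... | ()
  MuFrom-deterministic (mu-step p _) (mu-stop q) with ⇓-deterministic p q
  ... | ()
  MuFrom-deterministic (mu-step _ p) (mu-step _ q) = MuFrom-deterministic p q

MuFrom⇒root : ∀ {n} {f : PR (suc n)} {xs k y} → MuFrom f xs k y → f ⟦ y ∷ xs ⟧⇓ 0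
MuFrom⇒root (mu-stop p) = p
MuFrom⇒root (mu-step _ m) = MuFrom⇒root m

record Computable (n : ℕ) : Set where
  constructor computable
  field
    code  : PR n
    fn    : Vec ℕ n → ℕ
    code⇓ : ∀ xs → code ⟦ xs ⟧⇓ fn xs
open Computable public

withFn : ∀ {n} (C : Computable n) (f : Vec ℕ n → ℕ) → fn C ≗ f → Computable n
withFn C f eq = computable (code C) f (λ xs → subst (code C ⟦ xs ⟧⇓_) (eq xs) (code⇓ C xs))

fns : ∀ {m n} → Vec (Computable n) m → Vec ℕ n → Vec ℕ m
fns Cs xs = map (λ C → fn C xs) Cs

codes⇓fns : ∀ {m n} (Cs : Vec (Computable n) m) xs → map code Cs ⟦ xs ⟧⇓* fns Cs xs
codes⇓fns [] xs = ev-[]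
codes⇓fns (C ∷ Cs) xs = ev-∷ (code⇓ C xs) (codes⇓fns Cs xs)

zeroC : ∀ {n} → Computable n
zeroC = computable zer (λ _ → 0) (λ _ → ev-zer)

sucC : Computable 1
sucC = computable succ (λ { (x ∷ []) → suc x }) (λ { (x ∷ []) → ev-succ })

projC : ∀ {n} → Fin n → Computable n
projC i = computable (proj i) (λ xs → lookup xs i) (λ _ → ev-proj)

compC : ∀ {m n} → Computable m → Vec (Computable n) m → Computable n
compC F Gs = computable (comp (code F) (map code Gs)) (λ xs → fn F (fns Gs xs))
                        (λ xs → ev-comp (codes⇓fns Gs xs) (code⇓ F (fns Gs xs)))

precC : ∀ {n} (F : Computable n) (G : Computable (suc (suc n))) (h : Vec ℕ (suc n) → ℕ) →
        (∀ xs → h (0 ∷ xs) ≡ fn F xs) → (∀ k xs → h (suc k ∷ xs) ≡ fn G (k ∷ h (k ∷ xs) ∷ xs)) →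
        Computable (suc n)
precC F G h base step = computable (prec (code F) (code G)) h evaluates
  where
  evaluates : ∀ xs → prec (code F) (code G) ⟦ xs ⟧⇓ h xs
  evaluates (zero ∷ xs) = subst (_ ⟦ _ ⟧⇓_) (sym (base xs)) (ev-prec0 (code⇓ F xs))
  evaluates (suc k ∷ xs) = subst (_ ⟦ _ ⟧⇓_) (sym (step k xs)) (ev-precS (evaluates (k ∷ xs)) (code⇓ G _))

constC : ∀ {n} → ℕ → Computable n
constC c = withFn (raw c) (λ _ → c) (raw-fn c)
  where
  raw : ∀ {n} → ℕ → Computable n
  raw zero = zeroC
  raw (suc c) = compC sucC (raw c ∷ [])
  raw-fn : ∀ {n} c → fn (raw {n} c) ≗ λ _ → c
  raw-fn zero xs = refl
  raw-fn (suc c) xs = cong suc (raw-fn c xs)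

infix 5 if0_then_else_

if0_then_else_ : ℕ → ℕ → ℕ → ℕ
if0 zero then b else c = b
if0 suc _ then b else c = c

addC : Computable 2
addC = precC (projC zero) (compC sucC (projC (suc zero) ∷ [])) (λ { (a ∷ b ∷ []) → a + b })
             (λ { (b ∷ []) → refl }) (λ { k (b ∷ []) → refl })

predC : Computable 1
predC = precC zeroC (projC zero) (λ { (a ∷ []) → pred a }) (λ { [] → refl }) (λ { k [] → refl })

monusC : Computable 2
monusC = compC flipped (projC (suc zero) ∷ projC zero ∷ [])
  where
  flipped : Computable 2
  flipped = precC (projC zero) (compC predC (projC (suc zero) ∷ [])) (λ { (a ∷ b ∷ []) → b ∸ a })
                  (λ { (b ∷ []) → refl }) (λ { k (b ∷ []) → sym (pred[m∸n]≡m∸[1+n] b k) })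

if0C : Computable 3
if0C = precC (projC zero) (projC (suc (suc (suc zero))))
             (λ { (a ∷ b ∷ c ∷ []) → if0 a then b else c }) (λ { (b ∷ c ∷ []) → refl }) (λ { k (b ∷ c ∷ []) → refl })

infixl 6 _+ₑ_ _∸ₑ_
infix 5 if0ₑ_then_else_

data Expr (n : ℕ) : Set where
  var : Fin n → Expr n
  lit : ℕ → Expr n
  _+ₑ_ _∸ₑ_ : Expr n → Expr n → Expr n
  if0ₑ_then_else_ : Expr n → Expr n → Expr n → Expr n
  app : ∀ {m} → Computable m → Vec (Expr n) m → Expr n

mutual
  ⟦_⟧ₑ : ∀ {n} → Expr n → Vec ℕ n → ℕ
  ⟦ var i ⟧ₑ xs = lookup xs i
  ⟦ lit c ⟧ₑ xs = c
  ⟦ a +ₑ b ⟧ₑ xs = ⟦ a ⟧ₑ xs + ⟦ b ⟧ₑ xs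
  ⟦ a ∸ₑ b ⟧ₑ xs = ⟦ a ⟧ₑ xs ∸ ⟦ b ⟧ₑ xs
  ⟦ if0ₑ a then b else c ⟧ₑ xs = if0 ⟦ a ⟧ₑ xs then ⟦ b ⟧ₑ xs else ⟦ c ⟧ₑ xs
  ⟦ app C es ⟧ₑ xs = fn C (⟦ es ⟧ₑ* xs)

  ⟦_⟧ₑ* : ∀ {m n} → Vec (Expr n) m → Vec ℕ n → Vec ℕ m
  ⟦ [] ⟧ₑ* xs = []
  ⟦ e ∷ es ⟧ₑ* xs = ⟦ e ⟧ₑ xs ∷ ⟦ es ⟧ₑ* xs

mutual
  translate : ∀ {n} → Expr n → Computable n
  translate (var i) = projC i
  translate (lit c) = constC c
  translate (a +ₑ b) = compC addC (translate a ∷ translate b ∷ [])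
  translate (a ∸ₑ b) = compC monusC (translate a ∷ translate b ∷ [])
  translate (if0ₑ a then b else c) = compC if0C (translate a ∷ translate b ∷ translate c ∷ [])
  translate (app C es) = compC C (translate* es)

  translate* : ∀ {m n} → Vec (Expr n) m → Vec (Computable n) m
  translate* [] = []
  translate* (e ∷ es) = translate e ∷ translate* es

mutual
  translate-fn : ∀ {n} (e : Expr n) → fn (translate e) ≗ ⟦ e ⟧ₑ
  translate-fn (var i) xs = refl
  translate-fn (lit c) xs = refl
  translate-fn (a +ₑ b) xs = cong₂ _+_ (translate-fn a xs) (translate-fn b xs)
  translate-fn (a ∸ₑ b) xs = cong₂ _∸_ (translate-fn a xs) (translate-fn b xs)
  translate-fn (if0ₑ a then b else c) xs
    rewrite translate-fn a xs | translate-fn b xs | translate-fn c xs = refl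
  translate-fn (app C es) xs = cong (fn C) (translate*-fns es xs)

  translate*-fns : ∀ {m n} (es : Vec (Expr n) m) xs → fns (translate* es) xs ≡ ⟦ es ⟧ₑ* xs
  translate*-fns [] xs = refl
  translate*-fns (e ∷ es) xs = cong₂ _∷_ (translate-fn e xs) (translate*-fns es xs)

compile : ∀ {n} → Expr n → Computable n
compile e = withFn (translate e) ⟦ e ⟧ₑ (translate-fn e)

∑< : ℕ → (ℕ → ℕ) → ℕ
∑< zero f = 0
∑< (suc j) f = ∑< j f + f j

∑<≡0⇔ : ∀ j f → ∑< j f ≡ 0 ⇔ (∀ i → i < j → f i ≡ 0)
∑<≡0⇔ j f = mk⇔ (to j) (from j)
  where
  to : ∀ j → ∑< j f ≡ 0 → ∀ i → i < j → f i ≡ 0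
  to (suc j) eq i i<1+j with m≤n⇒m<n∨m≡n (≤-pred i<1+j)
  ... | inj₁ i<j = to j (m+n≡0⇒m≡0 _ eq) i i<j
  ... | inj₂ refl = m+n≡0⇒n≡0 _ eq
  from : ∀ j → (∀ i → i < j → f i ≡ 0) → ∑< j f ≡ 0
  from zero _ = refl
  from (suc j) zeros rewrite from j (λ i i<j → zeros i (m≤n⇒m≤1+n i<j)) | zeros j ≤-refl = refl

∑<-count : ∀ n j f → n ≤ j → (∀ i → i < n → f i ≡ 1) → (∀ i → n ≤ i → f i ≡ 0) → ∑< j f ≡ n
∑<-count n j f n≤j ones zeros with m≤n⇒m<n∨m≡n n≤j
... | inj₂ refl = all-ones n ones
  where
  all-ones : ∀ j → (∀ i → i < j → f i ≡ 1) → ∑< j f ≡ j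
  all-ones zero _ = refl
  all-ones (suc j) ones′ rewrite all-ones j (λ i i<j → ones′ i (m≤n⇒m≤1+n i<j)) | ones′ j ≤-refl = +-comm j 1
∑<-count n (suc j) f _ ones zeros | inj₁ n<1+j
  rewrite ∑<-count n j f (≤-pred n<1+j) ones zeros | zeros j (≤-pred n<1+j) = +-identityʳ n

sumC : ∀ {n} → Computable (suc n) → Computable (suc n)
sumC {n} C = precC zeroC step (λ { (j ∷ xs) → ∑< j (λ i → fn C (i ∷ xs)) }) (λ _ → refl)
  (λ k xs → cong (λ ys → ∑< k (λ i → fn C (i ∷ xs)) + fn C (k ∷ ys)) (sym (shift-fns k _ xs)))
  where
  shift : Vec (Computable (suc (suc n))) n
  shift = tabulate (λ i → projC (suc (suc i)))
  shift-fns : ∀ k a xs → fns shift (k ∷ a ∷ xs) ≡ xs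
  shift-fns k a xs =
    trans (sym (tabulate-∘ (λ C → fn C (k ∷ a ∷ xs)) (λ i → projC (suc (suc i))))) (tabulate∘lookup xs)
  step : Computable (suc (suc n))
  step = compC addC (projC (suc zero) ∷ compC C (projC zero ∷ shift) ∷ [])

bitℕ : Bool → ℕ
bitℕ false = 0
bitℕ true = 1

at : Str → ℕ → Bool
at σ i = fromMaybe false (head (drop i σ))

parity : ℕ → ℕ
parity zero = 0
parity (suc k) = 1 ∸ parity k

half : ℕ → ℕ
half zero = 0
half (suc k) = half k + parity k

parity-half-even : ∀ a → parity (2 * a) ≡ 0 × half (2 * a) ≡ a
parity-half-even zero = refl , refl
parity-half-even (suc a) =
  subst (λ n → parity n ≡ 0 × half n ≡ suc a) (sym (*-suc 2 a)) (two-more (parity-half-even a))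
  where
  two-more : parity (2 * a) ≡ 0 × half (2 * a) ≡ a → parity (2 + 2 * a) ≡ 0 × half (2 + 2 * a) ≡ suc a
  two-more (p , h) rewrite p | h = refl , trans (+-comm (a + 0) 1) (cong suc (+-identityʳ a))

parity-half-odd : ∀ a → parity (1 + 2 * a) ≡ 1 × half (1 + 2 * a) ≡ a
parity-half-odd a with parity-half-even a
... | p , h rewrite p | h = refl , +-identityʳ a

tl : ℕ → ℕ
tl c = half (c ∸ 1)

hd : ℕ → ℕ
hd c = parity (c ∸ 1)

tl-code : ∀ σ → tl ⌜ σ ⌝ ≡ ⌜ drop 1 σ ⌝
tl-code [] = refl
tl-code (false ∷ σ) = proj₂ (parity-half-even ⌜ σ ⌝)
tl-code (true ∷ σ) = proj₂ (parity-half-odd ⌜ σ ⌝)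

hd-code : ∀ σ → hd ⌜ σ ⌝ ≡ bitℕ (at σ 0)
hd-code [] = refl
hd-code (false ∷ σ) = proj₁ (parity-half-even ⌜ σ ⌝)
hd-code (true ∷ σ) = proj₁ (parity-half-odd ⌜ σ ⌝)

tls : ℕ → ℕ → ℕ
tls zero c = c
tls (suc i) c = tl (tls i c)

tls-code : ∀ i σ → tls i ⌜ σ ⌝ ≡ ⌜ drop i σ ⌝
tls-code zero σ = refl
tls-code (suc i) σ rewrite tls-code i σ | tl-code (drop i σ) | drop-drop i 1 σ | +-comm i 1 = refl

bit : ℕ → ℕ → ℕ
bit i c = hd (tls i c)

bit-code : ∀ i σ → bit i ⌜ σ ⌝ ≡ bitℕ (at σ i)
bit-code i σ rewrite tls-code i σ = hd-code (drop i σ)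

len : ℕ → ℕ
len c = ∑< c (λ i → if0 tls i c then 0 else 1)

length≤code : ∀ σ → length σ ≤ ⌜ σ ⌝
length≤code [] = z≤n
length≤code (false ∷ σ) = s≤s (≤-trans (length≤code σ) (m≤n*m ⌜ σ ⌝ 2))
length≤code (true ∷ σ) = m≤n⇒m≤1+n (s≤s (≤-trans (length≤code σ) (m≤n*m ⌜ σ ⌝ 2)))

len-code : ∀ σ → len ⌜ σ ⌝ ≡ length σ
len-code σ = ∑<-count (length σ) ⌜ σ ⌝ _ (length≤code σ) inside outside
  where
  nonempty : ∀ i (σ : Str) → i < length σ → if0 ⌜ drop i σ ⌝ then 0 else 1 ≡ 1
  nonempty zero (false ∷ σ) _ = refl
  nonempty zero (true ∷ σ) _ = refl
  nonempty (suc i) (_ ∷ σ) (s≤s i<n) = nonempty i σ i<n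
  inside : ∀ i → i < length σ → if0 tls i ⌜ σ ⌝ then 0 else 1 ≡ 1
  inside i i<n rewrite tls-code i σ = nonempty i σ i<n
  outside : ∀ i → length σ ≤ i → if0 tls i ⌜ σ ⌝ then 0 else 1 ≡ 0
  outside i n≤i rewrite tls-code i σ | drop-all i σ n≤i = refl

next : Str → Str
next [] = false ∷ []
next (false ∷ σ) = true ∷ σ
next (true ∷ σ) = false ∷ next σ

next-code : ∀ σ → ⌜ next σ ⌝ ≡ suc ⌜ σ ⌝
next-code [] = refl
next-code (false ∷ σ) = refl
next-code (true ∷ σ) rewrite next-code σ = cong (1 +_) (*-suc 2 ⌜ σ ⌝)

⌜⌝-surjective : ∀ d → ∃ λ σ → ⌜ σ ⌝ ≡ d
⌜⌝-surjective zero = [] , refl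
⌜⌝-surjective (suc d) with ⌜⌝-surjective d
... | σ , refl = next σ , next-code σ

parityC : Computable 1
parityC = precC zeroC (compile (lit 1 ∸ₑ var (suc zero))) (λ { (k ∷ []) → parity k })
                (λ { [] → refl }) (λ { k [] → refl })

halfC : Computable 1
halfC = precC zeroC (compile (var (suc zero) +ₑ app parityC (var zero ∷ []))) (λ { (k ∷ []) → half k })
              (λ { [] → refl }) (λ { k [] → refl })

tlsC : Computable 2
tlsC = precC (projC zero) (compile (app halfC ((var (suc zero) ∸ₑ lit 1) ∷ []))) (λ { (i ∷ c ∷ []) → tls i c })
             (λ { (c ∷ []) → refl }) (λ { k (c ∷ []) → refl })

bitC : Computable 2
bitC = compile (app parityC ((app tlsC (var zero ∷ var (suc zero) ∷ []) ∸ₑ lit 1) ∷ []))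

lenC : Computable 1
lenC = compile (app (sumC (compile (if0ₑ app tlsC (var zero ∷ var (suc zero) ∷ []) then lit 0 else lit 1)))
                    (var zero ∷ var zero ∷ []))

-- τ may be an initial segment of a set in the Mathias condition with stem φ and reservoir σ
Compatible : Str → Str → Str → Set
Compatible φ σ τ = ∀ i → i < length τ →
  (i < length φ → at τ i ≡ at φ i) × (length φ ≤ i → at τ i ≡ true → at σ i ≡ true)

false≢true : false ≢ true
false≢true ()

bit-implies : ∀ a b → bitℕ a ∸ bitℕ b ≡ 0 ⇔ (a ≡ true → b ≡ true)
bit-implies false false = mk⇔ (λ _ ()) (λ _ → refl)
bit-implies false true = mk⇔ (λ _ _ → refl) (λ _ → refl)
bit-implies true false = mk⇔ (λ ()) (λ t⇒f → ⊥-elim (false≢true (t⇒f refl)))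
bit-implies true true = mk⇔ (λ _ _ → refl) (λ _ → refl)

bit-equal : ∀ a b → (bitℕ a ∸ bitℕ b) + (bitℕ b ∸ bitℕ a) ≡ 0 ⇔ a ≡ b
bit-equal false false = mk⇔ (λ _ → refl) (λ _ → refl)
bit-equal false true = mk⇔ (λ ()) (λ ())
bit-equal true false = mk⇔ (λ ()) (λ ())
bit-equal true true = mk⇔ (λ _ → refl) (λ _ → refl)

mismatch : Str → ℕ → ℕ → ℕ → ℕ
mismatch φ i d c = if0 length φ ∸ i then bit i d ∸ bit i c
                   else (bit i d ∸ bit i ⌜ φ ⌝) + (bit i ⌜ φ ⌝ ∸ bit i d)

mismatch≡0⇔ : ∀ φ i τ σ → mismatch φ i ⌜ τ ⌝ ⌜ σ ⌝ ≡ 0 ⇔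
  ((i < length φ → at τ i ≡ at φ i) × (length φ ≤ i → at τ i ≡ true → at σ i ≡ true))
mismatch≡0⇔ φ i τ σ rewrite bit-code i τ | bit-code i σ | bit-code i φ with length φ ∸ i in eq
... | zero = mk⇔ (λ z → (λ i<m → ⊥-elim (<⇒≱ i<m m≤i)) , (λ _ → Equivalence.to (bit-implies _ _) z))
                 (λ (_ , beyond) → Equivalence.from (bit-implies _ _) (beyond m≤i))
  where m≤i = m∸n≡0⇒m≤n eq
... | suc _ = mk⇔ (λ z → (λ _ → Equivalence.to (bit-equal _ _) z) , (λ m≤i → ⊥-elim (<⇒≱ i<m m≤i)))
                  (λ (below , _) → Equivalence.from (bit-equal _ _) (below i<m))
  where i<m = m∸n≢0⇒n<m (λ e → 0≢1+n (trans (sym e) eq))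

defect : Str → ℕ → ℕ
defect φ c = ∑< (len (len c)) (λ i → mismatch φ i (len c) c)

defect≡0⇔ : ∀ φ σ τ → ⌜ τ ⌝ ≡ length σ → defect φ ⌜ σ ⌝ ≡ 0 ⇔ Compatible φ σ τ
defect≡0⇔ φ σ τ eq rewrite len-code σ | sym eq | len-code τ =
  mk⇔ (λ z i i<n → Equivalence.to (mismatch≡0⇔ φ i τ σ) (Equivalence.to (∑<≡0⇔ _ _) z i i<n))
      (λ compatible → Equivalence.from (∑<≡0⇔ _ _)
                        (λ i i<n → Equivalence.from (mismatch≡0⇔ φ i τ σ) (compatible i i<n)))

mismatchC : Str → Computable 3
mismatchC φ = compile (if0ₑ lit (length φ) ∸ₑ var zero then bitOf d ∸ₑ bitOf c
                       else (bitOf d ∸ₑ bitOf (lit ⌜ φ ⌝)) +ₑ (bitOf (lit ⌜ φ ⌝) ∸ₑ bitOf d))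
  where
  d c : Expr 3
  d = var (suc zero)
  c = var (suc (suc zero))
  bitOf : Expr 3 → Expr 3
  bitOf x = app bitC (var zero ∷ x ∷ [])

defectC : Str → Computable 1
defectC φ = compile (app (sumC (mismatchC φ)) (lenOf (lenOf (var zero)) ∷ lenOf (var zero) ∷ var zero ∷ []))
  where
  lenOf : Expr 1 → Expr 1
  lenOf x = app lenC (x ∷ [])

lengthC : Computable 2
lengthC = compile (app lenC (var zero ∷ []))

gateC : Str → Computable 3
gateC φ = compile (app (defectC φ) (var (suc zero) ∷ []))

-- On input (⌜ σ ⌝ , x), Θ e φ halts iff e halts on (|σ| , x) and the string coded by |σ| is
-- Compatible φ σ. Testing a single string per σ avoids dovetailing runs of e: along any set S
-- the lengths |S ↾ L| run through all codes.
Θ : Operator → Str → Operator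
Θ e φ = comp zer (comp e (code lengthC ∷ proj (suc zero) ∷ []) ∷ mu (code (gateC φ)) ∷ [])

Θ-sound : ∀ e φ σ x → (σ , x) ∈Θ Θ e φ →
          ∃ λ τ → ⌜ τ ⌝ ≡ length σ × Compatible φ σ τ × (τ , x) ∈Θ e
Θ-sound e φ σ x
  (_ , ev-comp (ev-∷ (ev-comp (ev-∷ {y = ℓ} length⇓ (ev-∷ ev-proj ev-[])) e⇓) (ev-∷ (ev-mu search) ev-[])) _)
  with ⌜⌝-surjective (length σ)
... | τ , τ-code = τ , τ-code , compatible , _ , subst (λ ℓ → e ⟦ ℓ ∷ x ∷ [] ⟧⇓ _) length≡ e⇓
  where
  length≡ : ℓ ≡ ⌜ τ ⌝
  length≡ = trans (⇓-deterministic length⇓ (code⇓ lengthC _)) (trans (len-code σ) (sym τ-code))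
  compatible : Compatible φ σ τ
  compatible = Equivalence.to (defect≡0⇔ φ σ τ τ-code)
                 (⇓-deterministic (code⇓ (gateC φ) _) (MuFrom⇒root search))

Θ-complete : ∀ e φ σ τ x → ⌜ τ ⌝ ≡ length σ → Compatible φ σ τ → (τ , x) ∈Θ e → (σ , x) ∈Θ Θ e φ
Θ-complete e φ σ τ x τ-code compatible (y , e⇓) =
  0 , ev-comp (ev-∷ (ev-comp (ev-∷ (code⇓ lengthC _) (ev-∷ ev-proj ev-[])) e⇓′)
                    (ev-∷ (ev-mu (mu-stop gate⇓0)) ev-[])) ev-zer
  where
  e⇓′ : e ⟦ len ⌜ σ ⌝ ∷ x ∷ [] ⟧⇓ y
  e⇓′ = subst (λ ℓ → e ⟦ ℓ ∷ x ∷ [] ⟧⇓ y) (trans τ-code (sym (len-code σ))) e⇓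
  gate⇓0 : code (gateC φ) ⟦ 0 ∷ ⌜ σ ⌝ ∷ x ∷ [] ⟧⇓ 0
  gate⇓0 = subst (code (gateC φ) ⟦ 0 ∷ ⌜ σ ⌝ ∷ x ∷ [] ⟧⇓_)
                 (Equivalence.from (defect≡0⇔ φ σ τ τ-code) compatible) (code⇓ (gateC φ) _)

next-pair : ℕ × ℕ → ℕ × ℕ
next-pair (a , zero) = 0 , suc a
next-pair (a , suc b) = suc a , b

unpair : ℕ → ℕ × ℕ
unpair zero = 0 , 0
unpair (suc k) = next-pair (unpair k)

unpair-surjective : ∀ a b → ∃ λ k → unpair k ≡ (a , b)
unpair-surjective a b = reach (a + b) a b refl
  where
  reach : ∀ n a b → a + b ≡ n → ∃ λ k → unpair k ≡ (a , b)
  reach zero zero zero _ = 0 , refl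
  reach (suc n) zero (suc b) eq with reach n b 0 (trans (+-identityʳ b) (suc-injective eq))
  ... | k , ek = suc k , cong next-pair ek
  reach n (suc a) b eq with reach n a (suc b) (trans (+-suc a b) eq)
  ... | k , ek = suc k , cong next-pair ek

toFin? : (n : ℕ) → ℕ → Maybe (Fin n)
toFin? zero _ = nothing
toFin? (suc n) zero = just zero
toFin? (suc n) (suc p) = Data.Maybe.map suc (toFin? n p)

toFin?-toℕ : ∀ {n} (i : Fin n) → toFin? n (toℕ i) ≡ just i
toFin?-toℕ zero = refl
toFin?-toℕ (suc i) rewrite toFin?-toℕ i = refl

successor : (n : ℕ) → PR n
successor (suc zero) = succ
successor _ = zer

-- decodePR fuel arity index; out-of-range data decode to zer
mutual
  decodePR : ℕ → (n : ℕ) → ℕ → PR n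
  decodePR zero n k = zer
  decodePR (suc f) n k = decodeTagged f n (unpair k)

  decodeTagged : ℕ → (n : ℕ) → ℕ × ℕ → PR n
  decodeTagged f n (0 , p) = zer
  decodeTagged f n (1 , p) = successor n
  decodeTagged f n (2 , p) = maybe proj zer (toFin? n p)
  decodeTagged f n (3 , p) = decodeComp f n (unpair p)
  decodeTagged f n (4 , p) = decodePrec f n (unpair p)
  decodeTagged f n (5 , p) = mu (decodePR f (suc n) p)
  decodeTagged f n (suc (suc (suc (suc (suc (suc _))))) , p) = zer

  decodeComp : ℕ → (n : ℕ) → ℕ × ℕ → PR n
  decodeComp f n (m , q) = comp (decodePR f m (proj₁ (unpair q))) (decodeVec f m n (proj₂ (unpair q)))

  decodePrec : ℕ → (n : ℕ) → ℕ × ℕ → PR n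
  decodePrec f zero _ = zer
  decodePrec f (suc n) (i , j) = prec (decodePR f n i) (decodePR f (suc (suc n)) j)

  decodeVec : ℕ → (m n : ℕ) → ℕ → Vec (PR n) m
  decodeVec f zero n k = []
  decodeVec f (suc m) n k = decodePR f n (proj₁ (unpair k)) ∷ decodeVec f m n (proj₂ (unpair k))

Decodable : ∀ {n} → PR n → Set
Decodable {n} c = ∃ λ k → ∃ λ F → ∀ f → F ≤ f → decodePR f n k ≡ c

DecodableVec : ∀ {m n} → Vec (PR n) m → Set
DecodableVec {m} {n} cs = ∃ λ k → ∃ λ F → ∀ f → F ≤ f → decodeVec f m n k ≡ cs

decodable-tagged : ∀ {n} tag p F (c : PR n) → (∀ f → F ≤ f → decodeTagged f n (tag , p) ≡ c) → Decodable c
decodable-tagged tag p F c decodes with unpair-surjective tag p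
... | k , ek = k , suc F , λ { (suc f) (s≤s F≤f) → trans (cong (decodeTagged f _) ek) (decodes f F≤f) }

mutual
  decodable : ∀ {n} (c : PR n) → Decodable c
  decodable zer = decodable-tagged 0 0 0 zer (λ _ _ → refl)
  decodable succ = decodable-tagged 1 0 0 succ (λ _ _ → refl)
  decodable (proj i) = decodable-tagged 2 (toℕ i) 0 (proj i) (λ _ _ → cong (maybe proj zer) (toFin?-toℕ i))
  decodable (comp {m} c cs) with decodable c | decodable-vec cs
  ... | kc , Fc , hc | ks , Fs , hs with unpair-surjective kc ks
  ...   | q , eq with unpair-surjective m q
  ...     | p , ep = decodable-tagged 3 p (Fc ⊔ Fs) (comp c cs) λ f le →
                       trans (cong (decodeComp f _) ep)
                         (trans (cong (λ u → comp (decodePR f m (proj₁ u)) (decodeVec f m _ (proj₂ u))) eq)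
                           (cong₂ comp (hc f (m⊔n≤o⇒m≤o Fc Fs le)) (hs f (m⊔n≤o⇒n≤o Fc Fs le))))
  decodable (prec c d) with decodable c | decodable d
  ... | kc , Fc , hc | kd , Fd , hd with unpair-surjective kc kd
  ...   | q , eq = decodable-tagged 4 q (Fc ⊔ Fd) (prec c d) λ f le →
                     trans (cong (decodePrec f _) eq)
                       (cong₂ prec (hc f (m⊔n≤o⇒m≤o Fc Fd le)) (hd f (m⊔n≤o⇒n≤o Fc Fd le)))
  decodable (mu c) with decodable c
  ... | kc , Fc , hc = decodable-tagged 5 kc Fc (mu c) λ f le → cong mu (hc f le)

  decodable-vec : ∀ {m n} (cs : Vec (PR n) m) → DecodableVec cs
  decodable-vec [] = 0 , 0 , λ _ _ → refl
  decodable-vec {n = n} (c ∷ cs) with decodable c | decodable-vec cs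
  ... | kc , Fc , hc | ks , Fs , hs with unpair-surjective kc ks
  ...   | k , ek = k , Fc ⊔ Fs , λ f le →
                     trans (cong (λ u → decodePR f n (proj₁ u) ∷ decodeVec f _ n (proj₂ u)) ek)
                       (cong₂ _∷_ (hc f (m⊔n≤o⇒m≤o Fc Fs le)) (hs f (m⊔n≤o⇒n≤o Fc Fs le)))

enum : ℕ → Operator
enum j = decodePR (proj₁ (unpair j)) 2 (proj₂ (unpair j))

enum-surjective : ∀ e → ∃ λ j → enum j ≡ e
enum-surjective e with decodable e
... | k , F , decodes with unpair-surjective F k
... | j , ej = j , trans (cong (λ u → decodePR (proj₁ u) 2 (proj₂ u)) ej) (decodes F ≤-refl)

∅ : Setℕ
∅ _ = false

∅-⊆ : ∀ X → ∅ ⊆ X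
∅-⊆ X n ()

⊆-refl : ∀ {X} → X ⊆ X
⊆-refl _ x∈X = x∈X

⊆-trans : ∀ {X Y Z} → X ⊆ Y → Y ⊆ Z → X ⊆ Z
⊆-trans X⊆Y Y⊆Z n n∈X = Y⊆Z n (X⊆Y n n∈X)

_≡[<_]_ : Setℕ → ℕ → Setℕ → Set
Y ≡[< m ] X = ∀ i → i < m → Y i ≡ X i

splice : ℕ → Setℕ → Setℕ → Setℕ
splice m X Y i with i <? m
... | yes _ = X i
... | no _ = Y i

splice-< : ∀ {m X Y i} → i < m → splice m X Y i ≡ X i
splice-< {m} {i = i} i<m with i <? m
... | yes _ = refl
... | no i≮m = ⊥-elim (i≮m i<m)

splice-≥ : ∀ {m X Y i} → m ≤ i → splice m X Y i ≡ Y i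
splice-≥ {m} {i = i} m≤i with i <? m
... | yes i<m = ⊥-elim (<⇒≱ i<m m≤i)
... | no _ = refl

splice-⊆ : ∀ m {X Y Z} → X ⊆ Z → Y ⊆ Z → splice m X Y ⊆ Z
splice-⊆ m X⊆Z Y⊆Z i with i <? m
... | yes _ = X⊆Z i
... | no _ = Y⊆Z i

splice-agrees : ∀ m {X Y} → splice m X Y ≡[< m ] X
splice-agrees m i i<m = splice-< i<m

splice-agrees-below : ∀ L {m X Y} → Y ≡[< m ] X → splice L Y X ≡[< m ] X
splice-agrees-below L Y≡X i i<m with i <? L
... | yes _ = Y≡X i i<m
... | no _ = refl

splice-infinite : ∀ m {X Y} → Infinite Y → Infinite (splice m X Y)
splice-infinite m Y-infinite n with Y-infinite (n ⊔ m)
... | k , n⊔m≤k , k∈Y = k , m⊔n≤o⇒m≤o n m n⊔m≤k , trans (splice-≥ (m⊔n≤o⇒n≤o n m n⊔m≤k)) k∈Y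

length-↾ : ∀ X n → length (X ↾ n) ≡ n
length-↾ X zero = refl
length-↾ X (suc n) = cong suc (length-↾ (λ k → X (suc k)) n)

at-↾ : ∀ X {n i} → i < n → at (X ↾ n) i ≡ X i
at-↾ X {suc n} {zero} _ = refl
at-↾ X {suc n} {suc i} (s≤s i<n) = at-↾ (λ k → X (suc k)) i<n

at-[] : ∀ i → at [] i ≡ false
at-[] i rewrite drop-[] {A = Bool} i = refl

at-↾-true : ∀ X n i → at (X ↾ n) i ≡ true → i ∈ X
at-↾-true X zero i eq = ⊥-elim (false≢true (trans (sym (at-[] i)) eq))
at-↾-true X (suc n) zero eq = eq
at-↾-true X (suc n) (suc i) eq = at-↾-true (λ k → X (suc k)) n i eq

≼-at : ∀ {σ X i} → σ ≼ X → i < length σ → at σ i ≡ X i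
≼-at {σ} {X} {i} σ≼X i<n = trans (cong (λ ρ → at ρ i) σ≼X) (at-↾ X i<n)

≼-at-true : ∀ {σ X i} → σ ≼ X → at σ i ≡ true → i ∈ X
≼-at-true {σ} {X} {i} σ≼X eq = at-↾-true X (length σ) i (trans (cong (λ ρ → at ρ i) (sym σ≼X)) eq)

↾-≼ : ∀ {X Y n} → X ≡[< n ] Y → (X ↾ n) ≼ Y
↾-≼ {X} {Y} {n} X≡Y = trans (agree n X≡Y) (cong (Y ↾_) (sym (length-↾ X n)))
  where
  agree : ∀ {X Y} n → X ≡[< n ] Y → X ↾ n ≡ Y ↾ n
  agree zero _ = refl
  agree (suc n) X≡Y = cong₂ _∷_ (X≡Y 0 (s≤s z≤n)) (agree n (λ i i<n → X≡Y (suc i) (s≤s i<n)))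

↾-length : ∀ {X} τ → (∀ i → i < length τ → X i ≡ at τ i) → X ↾ length τ ≡ τ
↾-length [] _ = refl
↾-length (b ∷ τ) X≡τ = cong₂ _∷_ (X≡τ 0 (s≤s z≤n)) (↾-length τ (λ i i<n → X≡τ (suc i) (s≤s i<n)))

compatible⇒extension : ∀ {m X S σ τ} → S ⊆ X → σ ≼ S → Compatible (X ↾ m) σ τ →
                       ∃ λ Y → Y ⊆ X × Y ≡[< m ] X × Y ↾ length τ ≡ τ
compatible⇒extension {m} {X} {S} {σ} {τ} S⊆X σ≼S compatible =
  Y , Y⊆X , Y≡X , ↾-length τ (λ i i<n → splice-< i<n)
  where
  Y : Setℕ
  Y = splice (length τ) (at τ) (splice m X ∅)
  below-stem : ∀ {i} → i < length τ → i < m → at τ i ≡ X i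
  below-stem {i} i<n i<m =
    trans (proj₁ (compatible i i<n) (subst (i <_) (sym (length-↾ X m)) i<m)) (at-↾ X i<m)
  Y⊆X : Y ⊆ X
  Y⊆X i i∈Y with i <? length τ
  ... | no _ = splice-⊆ m ⊆-refl (∅-⊆ X) i i∈Y
  ... | yes i<n with i <? m
  ...   | yes i<m = trans (sym (below-stem i<n i<m)) i∈Y
  ...   | no i≮m = S⊆X i (≼-at-true σ≼S (proj₂ (compatible i i<n)
                     (subst (_≤ i) (sym (length-↾ X m)) (≮⇒≥ i≮m)) i∈Y))
  Y≡X : Y ≡[< m ] X
  Y≡X i i<m with i <? length τ
  ... | yes i<n = below-stem i<n i<m
  ... | no _ = splice-< i<m

prefix⇒compatible : ∀ {m X S Y τ n} → τ ≼ Y → Y ⊆ splice m X S → Y ≡[< m ] X → length τ ≤ n →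
                    Compatible (X ↾ m) (S ↾ n) τ
prefix⇒compatible {m} {X} {S} {Y} {τ} {n} τ≼Y Y⊆ Y≡X |τ|≤n i i<|τ| = below , beyond
  where
  below : i < length (X ↾ m) → at τ i ≡ at (X ↾ m) i
  below i<φ = let i<m = subst (i <_) (length-↾ X m) i<φ in
    trans (≼-at τ≼Y i<|τ|) (trans (Y≡X i i<m) (sym (at-↾ X i<m)))
  beyond : length (X ↾ m) ≤ i → at τ i ≡ true → at (S ↾ n) i ≡ true
  beyond φ≤i τᵢ = trans (at-↾ S (<-≤-trans i<|τ| |τ|≤n))
    (trans (sym (splice-≥ (subst (_≤ i) (length-↾ X m) φ≤i))) (Y⊆ i (trans (sym (≼-at τ≼Y i<|τ|)) τᵢ)))

module _ (em : ExcludedMiddle 0ℓ) (A B : Setℕ) (B-infinite : Infinite B) (A≤B : A ≤ⁱ-ce B)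
         (no-uniform : ¬ (∃ λ (C : Setℕ) → C ⊆ B × Infinite C × A ≤ᵘⁱ-ce C)) where

  -- the Mathias condition with stem set ↾ height and reservoir set ∖ [0, height)
  record Condition : Set where
    constructor condition
    field
      height : ℕ
      set : Setℕ
      set⊆B : set ⊆ B
      set-infinite : Infinite set
  open Condition

  record _⊑_ (p q : Condition) : Set where
    constructor extends
    field
      height-≤ : height p ≤ height q
      set-⊆ : set q ⊆ set p
      set-agrees : set q ≡[< height p ] set p
  open _⊑_

  ⊑-refl : ∀ {p} → p ⊑ p
  ⊑-refl = extends ≤-refl ⊆-refl (λ _ _ → refl)

  ⊑-trans : ∀ {p q r} → p ⊑ q → q ⊑ r → p ⊑ r
  ⊑-trans (extends h₁ s₁ a₁) (extends h₂ s₂ a₂) =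
    extends (≤-trans h₁ h₂) (⊆-trans s₂ s₁) (λ i i<h → trans (a₂ i (≤-trans i<h h₁)) (a₁ i i<h))

  Forces : Operator → Condition → Set
  Forces e p = ∀ Y → Y ⊆ set p → Y ≡[< height p ] set p → ¬ e ⟨ Y ⟩≡ A

  module Step (p : Condition) (e : Operator) where
    private
      m = height p
      X = set p

    Extension : Set
    Extension = Σ Condition λ q → p ⊑ q × Forces e q

    EnumeratesNonMember : Set
    EnumeratesNonMember = ∃ λ x → ∃ λ Y → ∃ λ L →
      Y ⊆ X × Y ≡[< m ] X × ¬ x ∈ A × (Y ↾ L , x) ∈Θ e

    AvoidsMember : Set
    AvoidsMember = ∃ λ x → ∃ λ S → x ∈ A × S ⊆ X × S ≡[< m ] X × Infinite S ×
      (∀ Y → Y ⊆ S → Y ≡[< m ] S → ¬ x ∈Θ⟨ (e , Y) ⟩)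

    non-member⇒extension : EnumeratesNonMember → Extension
    non-member⇒extension (x , Y , L , Y⊆X , Y≡X , x∉A , x∈ΘY) =
      condition (m ⊔ L) X′ (⊆-trans X′⊆X (set⊆B p)) (splice-infinite L (set-infinite p)) ,
      extends (m≤m⊔n m L) X′⊆X (splice-agrees-below L Y≡X) , forces
      where
      X′ : Setℕ
      X′ = splice L Y X
      X′⊆X : X′ ⊆ X
      X′⊆X = splice-⊆ L Y⊆X ⊆-refl
      forces : ∀ Y′ → Y′ ⊆ X′ → Y′ ≡[< m ⊔ L ] X′ → ¬ e ⟨ Y′ ⟩≡ A
      forces Y′ _ Y′≡X′ e⟨Y′⟩≡A = x∉A (proj₂ (e⟨Y′⟩≡A x) (Y ↾ L , ↾-≼ Y≡Y′ , x∈ΘY))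
        where
        Y≡Y′ : Y ≡[< L ] Y′
        Y≡Y′ i i<L = sym (trans (Y′≡X′ i (<-≤-trans i<L (m≤n⊔m m L))) (splice-< i<L))

    avoids⇒extension : AvoidsMember → Extension
    avoids⇒extension (x , S , x∈A , S⊆X , S≡X , S-infinite , avoids) =
      condition m S (⊆-trans S⊆X (set⊆B p)) S-infinite , extends ≤-refl S⊆X S≡X ,
      λ Y Y⊆S Y≡S e⟨Y⟩≡A → avoids Y Y⊆S Y≡S (proj₁ (e⟨Y⟩≡A x) x∈A)

    C : Setℕ
    C = splice m ∅ X

    C⊆X : C ⊆ X
    C⊆X = splice-⊆ m (∅-⊆ X) ⊆-refl

    uniform : ¬ EnumeratesNonMember → ¬ AvoidsMember → A ≤ᵘⁱ-ce C
    uniform ¬non-member ¬avoids = Θ e (X ↾ m) , λ S S⊆C S-infinite x → complete S⊆C S-infinite , sound S⊆C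
      where
      sound : ∀ {S x} → S ⊆ C → x ∈Θ⟨ (Θ e (X ↾ m) , S) ⟩ → x ∈ A
      sound {S} {x} S⊆C (σ , σ≼S , σx∈Θ) with Θ-sound e (X ↾ m) σ x σx∈Θ
      ... | τ , _ , compatible , τx∈e with A x in Ax
      ...   | true = refl
      ...   | false with compatible⇒extension (⊆-trans S⊆C C⊆X) σ≼S compatible
      ...     | Y , Y⊆X , Y≡X , Y↾≡τ = ⊥-elim (¬non-member (x , Y , length τ , Y⊆X , Y≡X ,
                  (λ x∈A → false≢true (trans (sym Ax) x∈A)) , subst (λ ρ → (ρ , x) ∈Θ e) (sym Y↾≡τ) τx∈e))
      complete : ∀ {S x} → S ⊆ C → Infinite S → x ∈ A → x ∈Θ⟨ (Θ e (X ↾ m) , S) ⟩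
      complete {S} {x} S⊆C S-infinite x∈A with decidable-stable em enumerated
        where
        S′ : Setℕ
        S′ = splice m X S
        enumerated : ¬ ¬ (∃ λ Y → Y ⊆ S′ × Y ≡[< m ] S′ × x ∈Θ⟨ (e , Y) ⟩)
        enumerated ¬enumerated = ¬avoids (x , S′ , x∈A , splice-⊆ m ⊆-refl (⊆-trans S⊆C C⊆X) ,
          splice-agrees m , splice-infinite m S-infinite , λ Y Y⊆ Y≡ x∈ΘY → ¬enumerated (Y , Y⊆ , Y≡ , x∈ΘY))
      ... | Y , Y⊆S′ , Y≡S′ , τ , τ≼Y , τx∈e =
        S ↾ ⌜ τ ⌝ , cong (S ↾_) (sym (length-↾ S ⌜ τ ⌝)) ,
        Θ-complete e (X ↾ m) (S ↾ ⌜ τ ⌝) τ x (sym (length-↾ S ⌜ τ ⌝))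
          (prefix⇒compatible τ≼Y Y⊆S′ (λ i i<m → trans (Y≡S′ i i<m) (splice-< i<m)) (length≤code τ)) τx∈e

    extension : Extension
    extension with em {EnumeratesNonMember}
    ... | yes non-member = non-member⇒extension non-member
    ... | no ¬non-member with em {AvoidsMember}
    ...   | yes avoids = avoids⇒extension avoids
    ...   | no ¬avoids = ⊥-elim (no-uniform (C , (⊆-trans C⊆X (set⊆B p)) ,
                                  splice-infinite m (set-infinite p) , uniform ¬non-member ¬avoids))

  grow : Condition → Condition
  grow p = condition (suc (proj₁ (set-infinite p (height p)))) (set p) (set⊆B p) (set-infinite p)

  grow-⊑ : ∀ p → p ⊑ grow p
  grow-⊑ p = extends (m≤n⇒m≤1+n (proj₁ (proj₂ (set-infinite p (height p))))) ⊆-refl (λ _ _ → refl)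

  stage : ℕ → Condition
  stage zero = condition 0 B ⊆-refl B-infinite
  stage (suc k) = proj₁ (Step.extension (grow (stage k)) (enum k))

  stage-extension : ∀ k → Σ Condition λ q → grow (stage k) ⊑ q × Forces (enum k) q
  stage-extension k = Step.extension (grow (stage k)) (enum k)

  stage-⊑ : ∀ k → stage k ⊑ stage (suc k)
  stage-⊑ k = ⊑-trans (grow-⊑ (stage k)) (proj₁ (proj₂ (stage-extension k)))

  stage-forces : ∀ k → Forces (enum k) (stage (suc k))
  stage-forces k = proj₂ (proj₂ (stage-extension k))

  stage-new : ∀ k → ∃ λ n → height (stage k) ≤ n × n < height (stage (suc k)) × n ∈ set (stage (suc k))
  stage-new k with set-infinite (stage k) (height (stage k)) | proj₁ (proj₂ (stage-extension k))
  ... | n , h≤n , n∈X | extends grown≤ _ agrees = n , h≤n , grown≤ , trans (agrees n ≤-refl) n∈X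

  stage-chain : ∀ {j k} → j ≤′ k → stage j ⊑ stage k
  stage-chain ≤′-refl = ⊑-refl
  stage-chain (≤′-step {k} j≤k) = ⊑-trans (stage-chain j≤k) (stage-⊑ k)

  k≤height : ∀ k → k ≤ height (stage k)
  k≤height zero = z≤n
  k≤height (suc k) with stage-new k
  ... | _ , h≤n , n<h′ , _ = <-≤-trans (s≤s (k≤height k)) (<-≤-trans (s≤s h≤n) n<h′)

  generic : Setℕ
  generic n = set (stage (suc n)) n

  generic-agrees : ∀ k → generic ≡[< height (stage k) ] set (stage k)
  generic-agrees k n n<h with ≤-total k (suc n)
  ... | inj₁ k≤1+n = set-agrees (stage-chain (≤⇒≤′ k≤1+n)) n n<h
  ... | inj₂ 1+n≤k = sym (set-agrees (stage-chain (≤⇒≤′ 1+n≤k)) n (k≤height (suc n)))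

  generic-⊆ : ∀ k → generic ⊆ set (stage k)
  generic-⊆ k n n∈G with ≤-total k (suc n)
  ... | inj₁ k≤1+n = set-⊆ (stage-chain (≤⇒≤′ k≤1+n)) n n∈G
  ... | inj₂ 1+n≤k = trans (set-agrees (stage-chain (≤⇒≤′ 1+n≤k)) n (k≤height (suc n))) n∈G

  generic-infinite : Infinite generic
  generic-infinite j with stage-new j
  ... | n , h≤n , n<h′ , n∈X = n , ≤-trans (k≤height j) h≤n , trans (generic-agrees (suc j) n n<h′) n∈X

  no-uniform-absurd : ⊥
  no-uniform-absurd with A≤B generic (generic-⊆ 0) generic-infinite
  ... | e , e⟨G⟩≡A with enum-surjective e
  ...   | j , refl = stage-forces j generic (generic-⊆ (suc j)) (generic-agrees (suc j)) e⟨G⟩≡A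

proposition3p7 : ExcludedMiddle 0ℓ →
    (A B : Setℕ) → Infinite B → A ≤ⁱ-ce B →
    ∃ λ (C : Setℕ) → C ⊆ B × Infinite C × A ≤ᵘⁱ-ce C
proposition3p7 em A B B-infinite A≤B = decidable-stable em (no-uniform-absurd em A B B-infinite A≤B)
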